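{- Let $H_1$ and $H_2$ be finite simple graphs with disjoint vertex sets, and let $H=H_1\cup H_2$ be their union. Then $\varepsilon(H)\cong \varepsilon(H_1)\,\square\,\varepsilon(H_2)$.
   Context: The union $H_1\cup H_2$ has vertex set $V(H_1)\cup V(H_2)$ and edge set $E(H_1)\cup E(H_2)$. The Cartesian product $A\,\square\,B$ has vertex set $V(A)\times V(B)$, with $(a,b)\sim(a',b')$ iff ($a=a'$ and $b\sim b'$) or ($a\sim a'$ and $b=b'$). A dominating set of a graph $G$ is a set $D\subseteq V(G)$ such that every vertex of $V(G)\setminus D$ has a neighbour in $D$. The TARS-graph $\varepsilon(G)$ has as vertices the dominating sets of $G$; two distinct dominating sets $X,Y$ are adjacent iff either (i) $Y$ is obtained from $X$ by adding or deleting a single vertex of $G$, or (ii) there are vertices $u\in X$ and $v\in Y\setminus X$ that are adjacent in $G$ with $Y=(X\cup\{v\})\setminus\{u\}$. -}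

module Defs where

open import Level using (0ℓ)
open import Data.Nat using (ℕ; _+_)
open import Data.Fin using (Fin; splitAt)
open import Data.Fin.Subset using (Subset; _∈_; _∉_; _∪_; ⁅_⁆; _-_)
open import Data.Sum using (_⊎_; inj₁; inj₂)
open import Data.Product using (Σ; _×_; _,_; proj₁; proj₂; ∃; ∃-syntax)
open import Data.Empty using (⊥)
open import Relation.Nullary using (¬_)
open import Relation.Binary.PropositionalEquality using (_≡_; _≢_; refl)

record SimpleGraph : Set₁ where
  field
    n     : ℕ
    Adj   : Fin n → Fin n → Set
    sym   : ∀ {u v} → Adj u v → Adj v u
    irrefl : ∀ {u} → ¬ Adj u u

open SimpleGraph public

-- The vertex sets are
-- made disjoint by taking Fin m ⊎ Fin n, encoded as Fin (m + n)
-- (first m vertices = H₁, last n vertices = H₂).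

UnionAdj-split : (G₁ G₂ : SimpleGraph) →
  Fin (n G₁) ⊎ Fin (n G₂) → Fin (n G₁) ⊎ Fin (n G₂) → Set
UnionAdj-split G₁ G₂ (inj₁ a) (inj₁ b) = Adj G₁ a b
UnionAdj-split G₁ G₂ (inj₂ a) (inj₂ b) = Adj G₂ a b
UnionAdj-split G₁ G₂ (inj₁ a) (inj₂ b) = ⊥
UnionAdj-split G₁ G₂ (inj₂ a) (inj₁ b) = ⊥

UnionAdj-split-sym : (G₁ G₂ : SimpleGraph) → ∀ x y →
  UnionAdj-split G₁ G₂ x y → UnionAdj-split G₁ G₂ y x
UnionAdj-split-sym G₁ G₂ (inj₁ a) (inj₁ b) p = sym G₁ p
UnionAdj-split-sym G₁ G₂ (inj₂ a) (inj₂ b) p = sym G₂ p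

UnionAdj-split-irrefl : (G₁ G₂ : SimpleGraph) → ∀ x →
  ¬ UnionAdj-split G₁ G₂ x x
UnionAdj-split-irrefl G₁ G₂ (inj₁ a) = irrefl G₁
UnionAdj-split-irrefl G₁ G₂ (inj₂ a) = irrefl G₂

_∪G_ : SimpleGraph → SimpleGraph → SimpleGraph
G₁ ∪G G₂ = record
  { n      = n G₁ + n G₂
  ; Adj    = λ u v → UnionAdj-split G₁ G₂ (splitAt (n G₁) u) (splitAt (n G₁) v)
  ; sym    = λ {u} {v} → UnionAdj-split-sym G₁ G₂ (splitAt (n G₁) u) (splitAt (n G₁) v)
  ; irrefl = λ {u} → UnionAdj-split-irrefl G₁ G₂ (splitAt (n G₁) u)
  }

-- Graphs whose vertex type carries an equality (setoid-style), used for
-- the TARS-graph (vertices = dominating sets, compared by their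
-- underlying subset) and the Cartesian product.

record VGraph : Set₁ where
  field
    V    : Set
    _≈_  : V → V → Set
    E    : V → V → Set

_□_ : VGraph → VGraph → VGraph
A □ B = record
  { V   = VGraph.V A × VGraph.V B
  ; _≈_ = λ x y → VGraph._≈_ A (proj₁ x) (proj₁ y) × VGraph._≈_ B (proj₂ x) (proj₂ y)
  ; E   = λ x y → (VGraph._≈_ A (proj₁ x) (proj₁ y) × VGraph.E B (proj₂ x) (proj₂ y))
                ⊎ (VGraph.E A (proj₁ x) (proj₁ y) × VGraph._≈_ B (proj₂ x) (proj₂ y))
  }

record _≅_ (A B : VGraph) : Set where
  open VGraph A renaming (V to VA; _≈_ to _≈A_; E to EA)
  open VGraph B renaming (V to VB; _≈_ to _≈B_; E to EB)
  field
    to        : VA → VB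
    from      : VB → VA
    to-cong   : ∀ {x y} → x ≈A y → to x ≈B to y
    from-cong : ∀ {x y} → x ≈B y → from x ≈A from y
    from∘to   : ∀ x → from (to x) ≈A x
    to∘from   : ∀ y → to (from y) ≈B y
    to-adj    : ∀ {x y} → EA x y → EB (to x) (to y)
    to-adj⁻   : ∀ {x y} → EB (to x) (to y) → EA x y

module _ (G : SimpleGraph) where

  IsDominating : Subset (n G) → Set
  IsDominating D = ∀ v → v ∉ D → ∃[ u ] (u ∈ D × Adj G v u)

  DomSet : Set
  DomSet = Σ (Subset (n G)) IsDominating

  AddOrDelete : Subset (n G) → Subset (n G) → Set
  AddOrDelete X Y = ∃[ v ] ((v ∉ X × Y ≡ X ∪ ⁅ v ⁆) ⊎ (v ∈ X × Y ≡ X - v))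

  Slide : Subset (n G) → Subset (n G) → Set
  Slide X Y = ∃[ u ] ∃[ v ] (u ∈ X × v ∈ Y × v ∉ X × Adj G u v × Y ≡ (X ∪ ⁅ v ⁆) - u)

  TARSAdj : DomSet → DomSet → Set
  TARSAdj X Y = proj₁ X ≢ proj₁ Y × (AddOrDelete (proj₁ X) (proj₁ Y) ⊎ Slide (proj₁ X) (proj₁ Y))

  TARS : VGraph
  TARS = record
    { V   = DomSet
    ; _≈_ = λ X Y → proj₁ X ≡ proj₁ Y
    ; E   = TARSAdj
    }

{-# OPTIONS --safe #-}
-- No edge of H₁ ∪ H₂ joins the two parts, so a dominating set of H₁ ∪ H₂ is
-- exactly a pair of dominating sets of H₁ and H₂, and a TARS move (adding,
-- deleting, or sliding a token along an edge) changes only one part.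
-- Splitting a subset of V(H₁) ⊎ V(H₂) into its two halves therefore turns the
-- moves of ε(H₁ ∪ H₂) into moves in exactly one coordinate of ε(H₁) □ ε(H₂).
module Submission where

open import Defs hiding (sym)
open import Data.Nat using (ℕ; zero; suc; _+_)
open import Data.Bool using (true; false; _∨_)
open import Data.Fin using (Fin; zero; suc; _↑ˡ_; _↑ʳ_)
open import Data.Fin.Properties using (splitAt-↑ˡ; splitAt-↑ʳ)
open import Data.Fin.Subset using (Subset; _∈_; _∪_; _─_; ⁅_⁆; _-_) renaming (⊥ to ∅)
open import Data.Fin.Subset.Properties using (∪-identityʳ; p─⊥≡p)
open import Data.Vec using (Vec; _∷_; _++_; take; drop)
open import Data.Vec.Properties using (++-injective; zipWith-++; lookup-++ˡ; lookup-++ʳ; []=⇒lookup; lookup⇒[]=; take++drop≡id)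
open import Data.Sum using (_⊎_; inj₁; inj₂)
import Data.Sum as Sum
open import Data.Product using (_×_; _,_; proj₁; proj₂; map₁; map₂)
open import Data.Empty using (⊥-elim)
open import Relation.Nullary using (¬_)
open import Function using (id; _∘_)
open import Relation.Binary.PropositionalEquality

data SumView (m k : ℕ) : Fin (m + k) → Set where
  inl : (i : Fin m) → SumView m k (i ↑ˡ k)
  inr : (j : Fin k) → SumView m k (m ↑ʳ j)

sumView : ∀ m k (i : Fin (m + k)) → SumView m k i
sumView zero    k i       = inr i
sumView (suc m) k zero    = inl zero
sumView (suc m) k (suc i) with sumView m k i
... | inl i′ = inl (suc i′)
... | inr j  = inr j

take-drop-++ : ∀ {a} {X : Set a} m {k} (xs : Vec X m) (ys : Vec X k) →
               take m (xs ++ ys) ≡ xs × drop m (xs ++ ys) ≡ ys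
take-drop-++ m xs ys = ++-injective (take m (xs ++ ys)) xs (take++drop≡id m (xs ++ ys))

module _ {m k : ℕ} {A : Subset m} {B : Subset k} where

  ∈-++ˡ⁻ : ∀ {i} → i ↑ˡ k ∈ A ++ B → i ∈ A
  ∈-++ˡ⁻ {i} i∈ = lookup⇒[]= i A (trans (sym (lookup-++ˡ A B i)) ([]=⇒lookup i∈))

  ∈-++ˡ⁺ : ∀ {i} → i ∈ A → i ↑ˡ k ∈ A ++ B
  ∈-++ˡ⁺ {i} i∈ = lookup⇒[]= (i ↑ˡ k) (A ++ B) (trans (lookup-++ˡ A B i) ([]=⇒lookup i∈))

  ∈-++ʳ⁻ : ∀ {j} → m ↑ʳ j ∈ A ++ B → j ∈ B
  ∈-++ʳ⁻ {j} j∈ = lookup⇒[]= j B (trans (sym (lookup-++ʳ A B j)) ([]=⇒lookup j∈))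

  ∈-++ʳ⁺ : ∀ {j} → j ∈ B → m ↑ʳ j ∈ A ++ B
  ∈-++ʳ⁺ {j} j∈ = lookup⇒[]= (m ↑ʳ j) (A ++ B) (trans (lookup-++ʳ A B j) ([]=⇒lookup j∈))

∅-++ : ∀ m k → ∅ {m + k} ≡ ∅ {m} ++ ∅ {k}
∅-++ zero    k = refl
∅-++ (suc m) k = cong (false ∷_) (∅-++ m k)

⁅↑ˡ⁆ : ∀ {m} k (i : Fin m) → ⁅ i ↑ˡ k ⁆ ≡ ⁅ i ⁆ ++ ∅ {k}
⁅↑ˡ⁆ {suc m} k zero    = cong (true ∷_) (∅-++ m k)
⁅↑ˡ⁆ {suc m} k (suc i) = cong (false ∷_) (⁅↑ˡ⁆ k i)

⁅↑ʳ⁆ : ∀ m {k} (j : Fin k) → ⁅ m ↑ʳ j ⁆ ≡ ∅ {m} ++ ⁅ j ⁆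
⁅↑ʳ⁆ zero    j = refl
⁅↑ʳ⁆ (suc m) j = cong (false ∷_) (⁅↑ʳ⁆ m j)

─-++ : ∀ {m k} (A C : Subset m) (B D : Subset k) → (A ++ B) ─ (C ++ D) ≡ (A ─ C) ++ (B ─ D)
─-++ A C B D = zipWith-++ _ A B C D

module _ {m k : ℕ} (A : Subset m) (B : Subset k) where

  ∪⁅↑ˡ⁆ : ∀ i → (A ++ B) ∪ ⁅ i ↑ˡ k ⁆ ≡ (A ∪ ⁅ i ⁆) ++ B
  ∪⁅↑ˡ⁆ i = begin
    (A ++ B) ∪ ⁅ i ↑ˡ k ⁆     ≡⟨ cong ((A ++ B) ∪_) (⁅↑ˡ⁆ k i) ⟩
    (A ++ B) ∪ (⁅ i ⁆ ++ ∅)   ≡⟨ zipWith-++ _∨_ A B ⁅ i ⁆ ∅ ⟩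
    (A ∪ ⁅ i ⁆) ++ (B ∪ ∅)    ≡⟨ cong ((A ∪ ⁅ i ⁆) ++_) (∪-identityʳ B) ⟩
    (A ∪ ⁅ i ⁆) ++ B          ∎
    where open ≡-Reasoning

  ∪⁅↑ʳ⁆ : ∀ j → (A ++ B) ∪ ⁅ m ↑ʳ j ⁆ ≡ A ++ (B ∪ ⁅ j ⁆)
  ∪⁅↑ʳ⁆ j = begin
    (A ++ B) ∪ ⁅ m ↑ʳ j ⁆     ≡⟨ cong ((A ++ B) ∪_) (⁅↑ʳ⁆ m j) ⟩
    (A ++ B) ∪ (∅ ++ ⁅ j ⁆)   ≡⟨ zipWith-++ _∨_ A B ∅ ⁅ j ⁆ ⟩
    (A ∪ ∅) ++ (B ∪ ⁅ j ⁆)    ≡⟨ cong (_++ (B ∪ ⁅ j ⁆)) (∪-identityʳ A) ⟩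
    A ++ (B ∪ ⁅ j ⁆)          ∎
    where open ≡-Reasoning

  -↑ˡ : ∀ i → (A ++ B) - (i ↑ˡ k) ≡ (A - i) ++ B
  -↑ˡ i = begin
    (A ++ B) ─ ⁅ i ↑ˡ k ⁆     ≡⟨ cong ((A ++ B) ─_) (⁅↑ˡ⁆ k i) ⟩
    (A ++ B) ─ (⁅ i ⁆ ++ ∅)   ≡⟨ ─-++ A ⁅ i ⁆ B ∅ ⟩
    (A - i) ++ (B ─ ∅)        ≡⟨ cong ((A - i) ++_) (p─⊥≡p B) ⟩
    (A - i) ++ B              ∎
    where open ≡-Reasoning

  -↑ʳ : ∀ j → (A ++ B) - (m ↑ʳ j) ≡ A ++ (B - j)
  -↑ʳ j = begin
    (A ++ B) ─ ⁅ m ↑ʳ j ⁆     ≡⟨ cong ((A ++ B) ─_) (⁅↑ʳ⁆ m j) ⟩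
    (A ++ B) ─ (∅ ++ ⁅ j ⁆)   ≡⟨ ─-++ A ∅ B ⁅ j ⁆ ⟩
    (A ─ ∅) ++ (B - j)        ≡⟨ cong (_++ (B - j)) (p─⊥≡p A) ⟩
    A ++ (B - j)              ∎
    where open ≡-Reasoning

slide-↑ˡ : ∀ {m k} (A : Subset m) (B : Subset k) i i′ →
  ((A ++ B) ∪ ⁅ i′ ↑ˡ k ⁆) - (i ↑ˡ k) ≡ ((A ∪ ⁅ i′ ⁆) - i) ++ B
slide-↑ˡ {k = k} A B i i′ = trans (cong (_- (i ↑ˡ k)) (∪⁅↑ˡ⁆ A B i′)) (-↑ˡ (A ∪ ⁅ i′ ⁆) B i)

slide-↑ʳ : ∀ {m k} (A : Subset m) (B : Subset k) j j′ →
  ((A ++ B) ∪ ⁅ m ↑ʳ j′ ⁆) - (m ↑ʳ j) ≡ A ++ ((B ∪ ⁅ j′ ⁆) - j)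
slide-↑ʳ {m} A B j j′ = trans (cong (_- (m ↑ʳ j)) (∪⁅↑ʳ⁆ A B j′)) (-↑ʳ A (B ∪ ⁅ j′ ⁆) j)

Move : (G : SimpleGraph) → Subset (n G) → Subset (n G) → Set
Move G X Y = AddOrDelete G X Y ⊎ Slide G X Y

-- TARSAdj G is Step G on the underlying subsets.
Step : (G : SimpleGraph) → Subset (n G) → Subset (n G) → Set
Step G X Y = X ≢ Y × Move G X Y

module Union (H₁ H₂ : SimpleGraph) where

  private
    p = n H₁
    q = n H₂
    U = H₁ ∪G H₂

  adj-↑ˡ : ∀ a c → Adj U (a ↑ˡ q) (c ↑ˡ q) ≡ Adj H₁ a c
  adj-↑ˡ a c rewrite splitAt-↑ˡ p a q | splitAt-↑ˡ p c q = refl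

  adj-↑ʳ : ∀ b d → Adj U (p ↑ʳ b) (p ↑ʳ d) ≡ Adj H₂ b d
  adj-↑ʳ b d rewrite splitAt-↑ʳ p q b | splitAt-↑ʳ p q d = refl

  ¬adj-↑ˡ↑ʳ : ∀ a d → ¬ Adj U (a ↑ˡ q) (p ↑ʳ d)
  ¬adj-↑ˡ↑ʳ a d rewrite splitAt-↑ˡ p a q | splitAt-↑ʳ p q d = λ ()

  ¬adj-↑ʳ↑ˡ : ∀ b c → ¬ Adj U (p ↑ʳ b) (c ↑ˡ q)
  ¬adj-↑ʳ↑ˡ b c rewrite splitAt-↑ʳ p q b | splitAt-↑ˡ p c q = λ ()

  dominating-++⁻ˡ : ∀ {A B} → IsDominating U (A ++ B) → IsDominating H₁ A
  dominating-++⁻ˡ dom a a∉A with dom (a ↑ˡ q) (a∉A ∘ ∈-++ˡ⁻)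
  ... | u , u∈ , a~u with sumView p q u
  ...   | inl c = c , ∈-++ˡ⁻ u∈ , subst id (adj-↑ˡ a c) a~u
  ...   | inr d = ⊥-elim (¬adj-↑ˡ↑ʳ a d a~u)

  dominating-++⁻ʳ : ∀ {A B} → IsDominating U (A ++ B) → IsDominating H₂ B
  dominating-++⁻ʳ dom b b∉B with dom (p ↑ʳ b) (b∉B ∘ ∈-++ʳ⁻)
  ... | u , u∈ , b~u with sumView p q u
  ...   | inl c = ⊥-elim (¬adj-↑ʳ↑ˡ b c b~u)
  ...   | inr d = d , ∈-++ʳ⁻ u∈ , subst id (adj-↑ʳ b d) b~u

  dominating-++⁺ : ∀ {A B} → IsDominating H₁ A → IsDominating H₂ B → IsDominating U (A ++ B)
  dominating-++⁺ domA domB v v∉ with sumView p q v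
  ... | inl a with domA a (v∉ ∘ ∈-++ˡ⁺)
  ...   | c , c∈ , a~c = c ↑ˡ q , ∈-++ˡ⁺ c∈ , subst id (sym (adj-↑ˡ a c)) a~c
  dominating-++⁺ domA domB v v∉ | inr b with domB b (v∉ ∘ ∈-++ʳ⁺)
  ...   | d , d∈ , b~d = p ↑ʳ d , ∈-++ʳ⁺ d∈ , subst id (sym (adj-↑ʳ b d)) b~d

  module _ {A : Subset p} {B : Subset q} {C : Subset p} {D : Subset q} where

    addOrDelete-++⁻ : AddOrDelete U (A ++ B) (C ++ D) →
                      (AddOrDelete H₁ A C × B ≡ D) ⊎ (A ≡ C × AddOrDelete H₂ B D)
    addOrDelete-++⁻ (v , inj₁ (v∉ , eq)) with sumView p q v
    ... | inl a = let C≡ , D≡ = ++-injective C _ (trans eq (∪⁅↑ˡ⁆ A B a))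
                  in inj₁ ((a , inj₁ (v∉ ∘ ∈-++ˡ⁺ , C≡)) , sym D≡)
    ... | inr b = let C≡ , D≡ = ++-injective C _ (trans eq (∪⁅↑ʳ⁆ A B b))
                  in inj₂ (sym C≡ , (b , inj₁ (v∉ ∘ ∈-++ʳ⁺ , D≡)))
    addOrDelete-++⁻ (v , inj₂ (v∈ , eq)) with sumView p q v
    ... | inl a = let C≡ , D≡ = ++-injective C _ (trans eq (-↑ˡ A B a))
                  in inj₁ ((a , inj₂ (∈-++ˡ⁻ v∈ , C≡)) , sym D≡)
    ... | inr b = let C≡ , D≡ = ++-injective C _ (trans eq (-↑ʳ A B b))
                  in inj₂ (sym C≡ , (b , inj₂ (∈-++ʳ⁻ v∈ , D≡)))

    slide-++⁻ : Slide U (A ++ B) (C ++ D) → (Slide H₁ A C × B ≡ D) ⊎ (A ≡ C × Slide H₂ B D)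
    slide-++⁻ (u , v , u∈ , v∈ , v∉ , u~v , eq) with sumView p q u | sumView p q v
    ... | inl a | inl c =
      let C≡ , D≡ = ++-injective C _ (trans eq (slide-↑ˡ A B a c))
      in inj₁ ((a , c , ∈-++ˡ⁻ u∈ , ∈-++ˡ⁻ v∈ , v∉ ∘ ∈-++ˡ⁺ , subst id (adj-↑ˡ a c) u~v , C≡) , sym D≡)
    ... | inl a | inr d = ⊥-elim (¬adj-↑ˡ↑ʳ a d u~v)
    ... | inr b | inl c = ⊥-elim (¬adj-↑ʳ↑ˡ b c u~v)
    ... | inr b | inr d =
      let C≡ , D≡ = ++-injective C _ (trans eq (slide-↑ʳ A B b d))
      in inj₂ (sym C≡ , (b , d , ∈-++ʳ⁻ u∈ , ∈-++ʳ⁻ v∈ , v∉ ∘ ∈-++ʳ⁺ , subst id (adj-↑ʳ b d) u~v , D≡))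

  module _ {A : Subset p} {B : Subset q} where

    addOrDelete-++ˡ⁺ : ∀ {C} → AddOrDelete H₁ A C → AddOrDelete U (A ++ B) (C ++ B)
    addOrDelete-++ˡ⁺ (a , inj₁ (a∉ , refl)) = a ↑ˡ q , inj₁ (a∉ ∘ ∈-++ˡ⁻ , sym (∪⁅↑ˡ⁆ A B a))
    addOrDelete-++ˡ⁺ (a , inj₂ (a∈ , refl)) = a ↑ˡ q , inj₂ (∈-++ˡ⁺ a∈ , sym (-↑ˡ A B a))

    addOrDelete-++ʳ⁺ : ∀ {D} → AddOrDelete H₂ B D → AddOrDelete U (A ++ B) (A ++ D)
    addOrDelete-++ʳ⁺ (b , inj₁ (b∉ , refl)) = p ↑ʳ b , inj₁ (b∉ ∘ ∈-++ʳ⁻ , sym (∪⁅↑ʳ⁆ A B b))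
    addOrDelete-++ʳ⁺ (b , inj₂ (b∈ , refl)) = p ↑ʳ b , inj₂ (∈-++ʳ⁺ b∈ , sym (-↑ʳ A B b))

    slide-++ˡ⁺ : ∀ {C} → Slide H₁ A C → Slide U (A ++ B) (C ++ B)
    slide-++ˡ⁺ (a , c , a∈ , c∈ , c∉ , a~c , refl) =
      a ↑ˡ q , c ↑ˡ q , ∈-++ˡ⁺ a∈ , ∈-++ˡ⁺ c∈ , c∉ ∘ ∈-++ˡ⁻ ,
      subst id (sym (adj-↑ˡ a c)) a~c , sym (slide-↑ˡ A B a c)

    slide-++ʳ⁺ : ∀ {D} → Slide H₂ B D → Slide U (A ++ B) (A ++ D)
    slide-++ʳ⁺ (b , d , b∈ , d∈ , d∉ , b~d , refl) =
      p ↑ʳ b , p ↑ʳ d , ∈-++ʳ⁺ b∈ , ∈-++ʳ⁺ d∈ , d∉ ∘ ∈-++ʳ⁻ ,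
      subst id (sym (adj-↑ʳ b d)) b~d , sym (slide-↑ʳ A B b d)

  ProductStep : Subset p → Subset q → Subset p → Subset q → Set
  ProductStep A B C D = (A ≡ C × Step H₂ B D) ⊎ (Step H₁ A C × B ≡ D)

  module _ {A : Subset p} {B : Subset q} {C : Subset p} {D : Subset q} where

    move-++⁻ : Move U (A ++ B) (C ++ D) → (Move H₁ A C × B ≡ D) ⊎ (A ≡ C × Move H₂ B D)
    move-++⁻ (inj₁ m) = Sum.map (map₁ inj₁) (map₂ inj₁) (addOrDelete-++⁻ m)
    move-++⁻ (inj₂ m) = Sum.map (map₁ inj₂) (map₂ inj₂) (slide-++⁻ m)

    step-++⁻ : Step U (A ++ B) (C ++ D) → ProductStep A B C D
    step-++⁻ (AB≢CD , m) with move-++⁻ m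
    ... | inj₁ (m₁ , refl) = inj₂ ((AB≢CD ∘ cong (_++ B) , m₁) , refl)
    ... | inj₂ (refl , m₂) = inj₁ (refl , AB≢CD ∘ cong (A ++_) , m₂)

    step-++⁺ : ProductStep A B C D → Step U (A ++ B) (C ++ D)
    step-++⁺ (inj₁ (refl , B≢D , m)) = B≢D ∘ proj₂ ∘ ++-injective A A , Sum.map addOrDelete-++ʳ⁺ slide-++ʳ⁺ m
    step-++⁺ (inj₂ ((A≢C , m) , refl)) = A≢C ∘ proj₁ ∘ ++-injective A C , Sum.map addOrDelete-++ˡ⁺ slide-++ˡ⁺ m

  splitDom : DomSet U → DomSet H₁ × DomSet H₂
  splitDom (X , dom) = (take p X , dominating-++⁻ˡ dom′) , (drop p X , dominating-++⁻ʳ dom′)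
    where
    dom′ : IsDominating U (take p X ++ drop p X)
    dom′ = subst (IsDominating U) (sym (take++drop≡id p X)) dom

  joinDom : DomSet H₁ × DomSet H₂ → DomSet U
  joinDom ((A , domA) , (B , domB)) = A ++ B , dominating-++⁺ domA domB

  module _ {X Y : Subset (p + q)} where

    step-split⁻ : Step U X Y → ProductStep (take p X) (drop p X) (take p Y) (drop p Y)
    step-split⁻ = step-++⁻ ∘ subst₂ (Step U) (sym (take++drop≡id p X)) (sym (take++drop≡id p Y))

    step-split⁺ : ProductStep (take p X) (drop p X) (take p Y) (drop p Y) → Step U X Y
    step-split⁺ = subst₂ (Step U) (take++drop≡id p X) (take++drop≡id p Y) ∘ step-++⁺

mainTheorem4 : (H₁ H₂ : SimpleGraph) → TARS (H₁ ∪G H₂) ≅ (TARS H₁ □ TARS H₂)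
mainTheorem4 H₁ H₂ = record
  { to        = splitDom
  ; from      = joinDom
  ; to-cong   = λ X≡Y → cong (take (n H₁)) X≡Y , cong (drop (n H₁)) X≡Y
  ; from-cong = λ (A≡C , B≡D) → cong₂ _++_ A≡C B≡D
  ; from∘to   = λ (X , _) → take++drop≡id (n H₁) X
  ; to∘from   = λ ((A , _) , (B , _)) → take-drop-++ (n H₁) A B
  ; to-adj    = step-split⁻
  ; to-adj⁻   = step-split⁺
  }
  where open Union H₁ H₂
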